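{- The total number of distinct thin quartics in an $n\times n$ array $A$ is $\mathcal{O}(n^2 \log^2 n)$.
   Context: For an array $W$ and positive integers $\alpha,\beta$, $W^{\alpha,\beta}$ denotes the array composed of $\alpha\times\beta$ copies of $W$ ($\alpha$ copies vertically, $\beta$ horizontally). An array $B$ is primitive if $B=C^{\alpha,\beta}$ for some array $C$ and positive integers $\alpha,\beta$ implies $\alpha=\beta=1$. A quartic is an array of the form $V^{2,2}$. Every array $V$ equals $W^{\alpha,\beta}$ for a unique primitive array $W$ and positive integers $\alpha,\beta$. A quartic $V^{2,2}$ with $V=W^{\alpha,\beta}$, $W$ primitive, and at least one of $\alpha,\beta$ greater than $1$ (i.e., a non-primitively rooted quartic $W^{2\alpha,2\beta}$) is called thin if $\alpha=1$ or $\beta=1$. Quartics are counted as distinct by content (subarrays of $A$ with equal content count once). -}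

module Defs where

open import Data.Nat using (ℕ; _+_; _*_; _≤_; _<_)
open import Data.Fin using (Fin; cast; combine; _↑ˡ_; _↑ʳ_)
open import Data.Product using (Σ; ∃; _×_)
open import Data.Sum using (_⊎_)
open import Relation.Nullary using (¬_)
open import Relation.Binary.PropositionalEquality using (_≡_; sym)

record Arr (S : Set) : Set where
  constructor mkArr
  field
    rows : ℕ
    cols : ℕ
    at   : Fin rows → Fin cols → S
open Arr public

-- IsPower B C α β  :  B = C^{α,β}  (α copies vertically, β horizontally).
-- Entry (a·r + i , b·c + j) of B equals entry (i , j) of C.
IsPower : {S : Set} → Arr S → Arr S → ℕ → ℕ → Set
IsPower B C α β =
  Σ (rows B ≡ α * rows C) λ p →
  Σ (cols B ≡ β * cols C) λ q →
  (a : Fin α) (i : Fin (rows C)) (b : Fin β) (j : Fin (cols C)) →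
    at B (cast (sym p) (combine a i)) (cast (sym q) (combine b j)) ≡ at C i j

Primitive : {S : Set} → Arr S → Set
Primitive B = ∀ C α β → 1 ≤ α → 1 ≤ β → IsPower B C α β → (α ≡ 1 × β ≡ 1)

-- Thin quartic: W^{2α,2β} = (W^{α,β})^{2,2} with W primitive, α,β ≥ 1,
-- at least one of α,β > 1 (non-primitively rooted) and α = 1 or β = 1 (thin).
ThinQuartic : {S : Set} → Arr S → Set
ThinQuartic Q = ∃ λ W → ∃ λ α → ∃ λ β →
  Primitive W × 1 ≤ α × 1 ≤ β × (1 < α ⊎ 1 < β) × (α ≡ 1 ⊎ β ≡ 1) ×
  IsPower Q W (2 * α) (2 * β)

OccursIn : {S : Set} {n : ℕ} → Arr S → (Fin n → Fin n → S) → Set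
OccursIn {n = n} Q A =
  ∃ λ r → ∃ λ s → ∃ λ c → ∃ λ t →
  Σ (r + rows Q + s ≡ n) λ p →
  Σ (c + cols Q + t ≡ n) λ q →
  ∀ i j → at Q i j ≡ A (cast p ((r ↑ʳ i) ↑ˡ s)) (cast q ((c ↑ʳ j) ↑ˡ t))

SameContent : {S : Set} → Arr S → Arr S → Set
SameContent X Y =
  Σ (rows X ≡ rows Y) λ p →
  Σ (cols X ≡ cols Y) λ q →
  ∀ i j → at X i j ≡ at Y (cast p i) (cast q j)

Distinct : {S : Set} → Arr S → Arr S → Set
Distinct X Y = ¬ SameContent X Y

module Submission where

open import Defs
open import Data.Nat using (ℕ; _*_; _^_; _≤_)
open import Data.Nat.Logarithm using (⌊log₂_⌋)
open import Data.Fin using (Fin)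
open import Data.List using (List; length)
open import Data.List.Relation.Unary.All using (All)
open import Data.List.Relation.Unary.AllPairs using (AllPairs)
open import Data.Product using (∃; _×_)

open import Data.Nat using (zero; suc; _+_; _<_; z≤n; s≤s; NonZero; >-nonZero)
open import Data.Nat.Properties
open import Data.Nat.Divisibility using (_∣_; divides; ∣⇒≤; ∣-refl; ∣m∣n⇒∣m+n)
open import Data.Nat.DivMod using (_%_; _/_; _mod_; m≡m%n+[m/n]*n; m<n⇒m%n≡m; [m+n]%n≡m%n; m<n*o⇒m/o<n)
open import Data.Nat.Logarithm using (⌊log₂⌋-mono-≤; ⌊log₂[2*b]⌋≡1+⌊log₂b⌋)
open import Data.Nat.Tactic.RingSolver using (solve-∀)
open import Data.Nat.Induction using (<-wellFounded)
open import Induction.WellFounded using (Acc; acc)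
open import Data.Fin using (zero; suc; toℕ; fromℕ<; inject≤; cast; combine; _↑ˡ_; _↑ʳ_; splitAt; join)
open import Data.Fin.Properties
  using (toℕ-injective; toℕ-cast; toℕ-combine; toℕ<n; toℕ-fromℕ<; fromℕ<-cong; toℕ-inject≤; toℕ-↑ˡ; toℕ-↑ʳ;
         combine-injective; splitAt-join)
open import Data.List using ([]; _∷_; filter; map)
open import Data.List.Properties using (length-map)
open import Data.List.Relation.Unary.All using ([]; _∷_)
import Data.List.Relation.Unary.All as All
import Data.List.Relation.Unary.All.Properties as AllP
open import Data.List.Relation.Unary.AllPairs using ([]; _∷_)
import Data.List.Relation.Unary.AllPairs.Properties as AllPairs
open import Data.Product using (Σ; ∃₂; _,_; proj₁; proj₂; swap)
open import Data.Sum using (_⊎_; inj₁; inj₂)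
open import Data.Sum.Properties using (inj₁-injective; inj₂-injective)
open import Data.Empty using (⊥; ⊥-elim)
open import Function using (flip; _∘_)
open import Level using (0ℓ)
open import Effect.Monad using (RawMonad)
open import Relation.Nullary using (¬_; yes; no; ¬?)
open import Relation.Nullary.Negation using (¬¬-Monad; ¬¬-map)
open import Relation.Nullary.Decidable using (¬¬-excluded-middle; decidable-stable)
open import Relation.Unary using (Decidable)
open import Relation.Binary using (Setoid; tri<; tri≈; tri>)
open import Relation.Binary.PropositionalEquality as ≡ using (_≡_; refl; cong; cong₂; subst; subst₂)

-- A thin quartic is W^{2,2β} with W primitive and β ≥ 2 ("horizontal"), or the
-- transpose of one.  Classically, a horizontal quartic Q occurring in A may be
-- anchored at an occurrence (r , c) with c maximal; we call the resulting data a
-- frame, and key Q by its orientation, (r , c) and the dyadic classes of the sides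
-- h × w of W.  There are 2 n² (⌊log₂ n⌋ + 1)² keys, and at most two distinct
-- quartics share a key:
--   * equal heights force equal widths (Fine–Wilf on the columns and primitivity
--     of W) and equal exponents β (maximality of c), hence equal contents;
--   * heights h₁ < h₂ < h₃ < 2h₁ give three squares of rows starting at the same
--     place, excluded by the three-squares lemma as W is primitive.  The argument runs under double
-- negation, which the decidable conclusion removes.

positive-gap : ∀ {a e} → a < a + e → 0 < e
positive-gap {a} {zero} lt = ⊥-elim (<-irrefl (≡.sym (+-identityʳ a)) lt)
positive-gap {a} {suc e} _ = s≤s z≤n

twice : ∀ a → 2 * a ≡ a + a
twice a = cong (a +_) (+-identityʳ a)

dyadic-close : ∀ {x y} → 0 < y → ⌊log₂ x ⌋ ≡ ⌊log₂ y ⌋ → x < 2 * y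
dyadic-close {x} {y} 0<y same-log with x <? 2 * y
... | yes x<2y = x<2y
... | no x≮2y = ⊥-elim (<-irrefl refl (begin-strict
  ⌊log₂ y ⌋         <⟨ n<1+n _ ⟩
  1 + ⌊log₂ y ⌋     ≡⟨ ⌊log₂[2*b]⌋≡1+⌊log₂b⌋ y {{>-nonZero 0<y}} ⟨
  ⌊log₂ (2 * y) ⌋   ≤⟨ ⌊log₂⌋-mono-≤ (≮⇒≥ x≮2y) ⟩
  ⌊log₂ x ⌋         ≡⟨ same-log ⟩
  ⌊log₂ y ⌋         ∎))
  where open ≤-Reasoning

module Periodicity {a ℓ} (X : Setoid a ℓ) where
  open Setoid X using (Carrier; _≈_; sym)
  open import Relation.Binary.Reasoning.Setoid X

  Word : Set a
  Word = ℕ → Carrier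

  Period : Word → ℕ → ℕ → Set ℓ
  Period u p len = ∀ t → t + p < len → u t ≈ u (t + p)

  PrimitivePrefix : Word → ℕ → Set ℓ
  PrimitivePrefix u len = ∀ g → 0 < g → g ∣ len → g < len → Period u g len → ⊥

  CommonDivisorPeriod : Word → ℕ → ℕ → ℕ → Set ℓ
  CommonDivisorPeriod u p q len = Σ ℕ λ g → 0 < g × g ∣ p × g ∣ q × Period u g len


  period-prefix : ∀ {u p len len′} → len′ ≤ len → Period u p len → Period u p len′
  period-prefix len′≤len P t lt = P t (<-≤-trans lt len′≤len)

  period-extend : ∀ {u p g a b} → 0 < p → p + g ≤ a → Period u p b → Period u g a → Period u g b
  period-extend {u} {p} {g} {a} {b} 0<p p+g≤a Pp Pg t = go t (<-wellFounded t)
    where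
    go : ∀ t → Acc _<_ t → t + g < b → u t ≈ u (t + g)
    go t (acc rec) t+g<b with t + g <? a
    ... | yes t+g<a = Pg t t+g<a
    ... | no t+g≮a with m≤n⇒∃[o]m+o≡n (+-cancelʳ-≤ g p t (≤-trans p+g≤a (≮⇒≥ t+g≮a)))
    ... | t′ , refl = begin
          u (p + t′)       ≡⟨ cong u (+-comm p t′) ⟩
          u (t′ + p)       ≈⟨ sym (Pp t′ t′+p<b) ⟩
          u t′             ≈⟨ go t′ (rec (m<n+m t′ 0<p)) t′+g<b ⟩
          u (t′ + g)       ≈⟨ Pp (t′ + g) (subst (_< b) (≡.sym shift) t+g<b) ⟩
          u (t′ + g + p)   ≡⟨ cong u shift ⟩
          u (p + t′ + g)   ∎
      where
      shift : t′ + g + p ≡ p + t′ + g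
      shift = ≡.trans (+-comm (t′ + g) p) (≡.sym (+-assoc p t′ g))
      t′+p<b : t′ + p < b
      t′+p<b = ≤-<-trans (≤-trans (≤-reflexive (+-comm t′ p)) (m≤m+n (p + t′) g)) t+g<b
      t′+g<b : t′ + g < b
      t′+g<b = ≤-<-trans (+-monoˡ-≤ g (m≤n+m t′ p)) t+g<b

  period-difference : ∀ {u p e len} → Period u p (p + len) → Period u (p + e) (p + len) → Period u e len
  period-difference {u} {p} {e} {len} Pp Pq t t+e<len = begin
    u t             ≈⟨ Pq t (subst (_< p + len) (rearrange p t e) (+-monoʳ-< p t+e<len)) ⟩
    u (t + (p + e)) ≡⟨ cong u (≡.trans (≡.sym (rearrange p t e)) (+-comm p (t + e))) ⟩
    u (t + e + p)   ≈⟨ sym (Pp (t + e) (subst (_< p + len) (+-comm p (t + e)) (+-monoʳ-< p t+e<len))) ⟩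
    u (t + e)       ∎
    where
    rearrange : ∀ p t e → p + (t + e) ≡ t + (p + e)
    rearrange = solve-∀

  -- Euclid's
  -- subtractive algorithm on the periods, by induction on a bound k ≥ p + q.
  fine-wilf : ∀ {u p q len} → 0 < p → 0 < q → p + q ≤ len → Period u p len → Period u q len →
              CommonDivisorPeriod u p q len
  fine-wilf {u} {p} {q} = bounded (p + q) ≤-refl
    where
    bounded : ∀ k {p q len} → p + q ≤ k → 0 < p → 0 < q → p + q ≤ len → Period u p len → Period u q len →
              CommonDivisorPeriod u p q len
    subtract : ∀ k {p q len} → p + q ≤ suc k → 0 < p → p < q → p + q ≤ len → Period u p len → Period u q len →
               CommonDivisorPeriod u p q len

    bounded zero {p} p+q≤0 0<p _ _ _ _ = ⊥-elim (<-irrefl refl (<-≤-trans 0<p (≤-trans (m≤m+n p _) p+q≤0)))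
    bounded (suc k) {p} {q} {len} bound 0<p 0<q le Pp Pq with <-cmp p q
    ... | tri≈ _ refl _ = p , 0<p , ∣-refl , ∣-refl , Pp
    ... | tri< p<q _ _ = subtract k bound 0<p p<q le Pp Pq
    ... | tri> _ _ q<p =
      exchange (subtract k (subst (_≤ suc k) (+-comm p q) bound) 0<q q<p (subst (_≤ len) (+-comm p q) le) Pq Pp)
      where
      exchange : CommonDivisorPeriod u q p len → CommonDivisorPeriod u p q len
      exchange (g , 0<g , g∣q , g∣p , Pg) = g , 0<g , g∣p , g∣q , Pg

    -- for q = p + e, e is a period of the prefix of length len - p: recurse on (p , e)
    subtract k {p} {q} bound 0<p p<q le Pp Pq with m≤n⇒∃[o]m+o≡n (<⇒≤ p<q) | m≤n⇒∃[o]m+o≡n (m+n≤o⇒m≤o p le)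
    ... | zero , refl | _ = ⊥-elim (<-irrefl (≡.sym (+-identityʳ p)) p<q)
    ... | suc e , refl | len′ , refl =
      lift (bounded k smaller 0<p (s≤s z≤n) p+e≤len′ (period-prefix (m≤n+m len′ p) Pp) (period-difference Pp Pq))
      where
      smaller : p + suc e ≤ k
      smaller = ≤-pred (≤-trans (m<n+m (p + suc e) 0<p) bound)
      p+e≤len′ : p + suc e ≤ len′
      p+e≤len′ = +-cancelˡ-≤ p _ _ le
      -- a common period of p and e extends along p to the whole prefix
      lift : CommonDivisorPeriod u p (suc e) len′ → CommonDivisorPeriod u p (p + suc e) (p + len′)
      lift (g , 0<g , g∣p , g∣e , Pg) =
        g , 0<g , g∣p , ∣m∣n⇒∣m+n g∣p g∣e , period-extend 0<p (≤-trans (+-monoʳ-≤ p (∣⇒≤ g∣e)) p+e≤len′) Pp Pg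

  period-iterate : ∀ {u g len} → Period u g len → ∀ k j → g * k + j < len → u (g * k + j) ≈ u j
  period-iterate {u} {g} Pg zero j _ = Setoid.reflexive X (cong (λ i → u (i + j)) (*-zeroʳ g))
  period-iterate {u} {g} {len} Pg (suc k) j lt = begin
    u (g * suc k + j)   ≡⟨ cong u (step g k j) ⟩
    u (g * k + j + g)   ≈⟨ sym (Pg (g * k + j) (subst (_< len) (step g k j) lt)) ⟩
    u (g * k + j)       ≈⟨ period-iterate Pg k j (≤-<-trans (+-monoˡ-≤ j (*-monoʳ-≤ g (n≤1+n k))) lt) ⟩
    u j                 ∎
    where
    step : ∀ g k j → g * suc k + j ≡ g * k + j + g
    step = solve-∀

  period-agree : ∀ {u v p len} → (∀ t → t < len → u t ≈ v t) → Period u p len → Period v p len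
  period-agree {u} {v} {p} agree Pu t lt = begin
    v t         ≈⟨ sym (agree t (≤-<-trans (m≤m+n t p) lt)) ⟩
    u t         ≈⟨ Pu t lt ⟩
    u (t + p)   ≈⟨ agree (t + p) lt ⟩
    v (t + p)   ∎

  primitive-agree : ∀ {u v len} → (∀ t → t < len → u t ≈ v t) → PrimitivePrefix u len → PrimitivePrefix v len
  primitive-agree agree prim g 0<g g∣len g<len Pv =
    prim g 0<g g∣len g<len (period-agree (λ t lt → sym (agree t lt)) Pv)

  primitive-divisor : ∀ {u g len} → PrimitivePrefix u len → 0 < len → 0 < g → g ∣ len → Period u g len → g ≡ len
  primitive-divisor {u} {g} {len} prim 0<len 0<g g∣len Pg with g <? len
  ... | yes g<len = ⊥-elim (prim g 0<g g∣len g<len Pg)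
  ... | no g≮len = ≤-antisym (∣⇒≤ {{>-nonZero 0<len}} g∣len) (≮⇒≥ g≮len)

  squares-difference : ∀ {u a e} → Period u a (2 * a) → Period u (a + e) (2 * (a + e)) → Period u e a
  squares-difference {u} {a} {e} Pa Pb =
    period-difference (period-prefix (≤-reflexive (≡.sym (twice a))) Pa)
                      (period-prefix (≤-trans (≤-reflexive (≡.sym (twice a))) (*-monoʳ-≤ 2 (m≤m+n a e))) Pb)

  three-squares : ∀ {u a b c} → a < b → b < c → c < 2 * a →
                  Period u a (2 * a) → Period u b (2 * b) → Period u c (2 * c) → PrimitivePrefix u a → ⊥
  three-squares {u} {a} a<b b<c c<2a Pa Pb Pc prim
    with m≤n⇒∃[o]m+o≡n (<⇒≤ a<b) | m≤n⇒∃[o]m+o≡n (<⇒≤ b<c)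
  ... | e , refl | d , refl = refute (fine-wilf 0<d 0<e d+e≤a (period-prefix (m≤m+n a e) Pd) Pe)
    where
    Pe : Period u e a
    Pe = squares-difference Pa Pb
    Pd : Period u d (a + e)
    Pd = squares-difference Pb Pc
    0<e : 0 < e
    0<e = positive-gap a<b
    0<d : 0 < d
    0<d = positive-gap b<c
    e+d<a : e + d < a
    e+d<a = +-cancelˡ-< a (e + d) a (subst₂ _<_ (+-assoc a e d) (twice a) c<2a)
    d+e≤a : d + e ≤ a
    d+e≤a = subst (_≤ a) (+-comm e d) (<⇒≤ e+d<a)
    e<a : e < a
    e<a = ≤-<-trans (m≤m+n e d) e+d<a

    refute : CommonDivisorPeriod u d e a → ⊥
    refute (g , 0<g , g∣d , g∣e , Pg) =
      refute′ (fine-wilf 0<g (≤-<-trans z≤n e<a) (subst (_≤ a + e) (+-comm a g) (+-monoʳ-≤ a g≤e))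
                         Pg′ (period-prefix (<⇒≤ (<-trans b<c c<2a)) Pa))
      where
      g≤e : g ≤ e
      g≤e = ∣⇒≤ {{>-nonZero 0<e}} g∣e
      -- the common period g of d and e spreads to the prefix a + e along the period d
      Pg′ : Period u g (a + e)
      Pg′ = period-extend 0<d (≤-trans (+-monoʳ-≤ d g≤e) d+e≤a) Pd Pg
      -- g′ divides a, and is a proper period of the prefix a
      refute′ : CommonDivisorPeriod u g a (a + e) → ⊥
      refute′ (g′ , 0<g′ , g′∣g , g′∣a , Pg′′) =
        prim g′ 0<g′ g′∣a (≤-<-trans (∣⇒≤ {{>-nonZero 0<g}} g′∣g) (≤-<-trans g≤e e<a)) (period-prefix (m≤m+n a e) Pg′′)

-- Sequences compared on their first d entries: letters of width d.
Letters : Set → ℕ → Setoid 0ℓ 0ℓ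
Letters S d = record
  { Carrier       = ℕ → S
  ; _≈_           = λ x y → ∀ s → s < d → x s ≡ y s
  ; isEquivalence = record
    { refl  = λ _ _ → refl
    ; sym   = λ x≈y s lt → ≡.sym (x≈y s lt)
    ; trans = λ x≈y y≈z s lt → ≡.trans (x≈y s lt) (y≈z s lt)
    }
  }

-- An ℕ-indexed array q is read as the word of its rows (letter t is row t);
-- its columns are the rows of flip q.
module _ {S : Set} where
  open Periodicity

  RowPeriod : (ℕ → ℕ → S) → ℕ → ℕ → ℕ → Set
  RowPeriod q d = Period (Letters S d) q

  ColPeriod : (ℕ → ℕ → S) → ℕ → ℕ → ℕ → Set
  ColPeriod q d = RowPeriod (flip q) d

  RowPrimitive : (ℕ → ℕ → S) → ℕ → ℕ → Set
  RowPrimitive q d = PrimitivePrefix (Letters S d) q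

  ColPrimitive : (ℕ → ℕ → S) → ℕ → ℕ → Set
  ColPrimitive q d = RowPrimitive (flip q) d

  narrow : ∀ {q d d′ p len} → d′ ≤ d → RowPeriod q d p len → RowPeriod q d′ p len
  narrow d′≤d P t lt s s<d′ = P t lt s (<-≤-trans s<d′ d′≤d)

  widen-primitive : ∀ {q d d′ len} → d ≤ d′ → RowPrimitive q d len → RowPrimitive q d′ len
  widen-primitive d≤d′ prim g 0<g g∣len g<len P = prim g 0<g g∣len g<len (narrow d≤d′ P)

  Agree : ℕ → ℕ → (ℕ → ℕ → S) → (ℕ → ℕ → S) → Set
  Agree H W q q′ = ∀ t s → t < H → s < W → q t s ≡ q′ t s

  agree-transpose : ∀ {H W q q′} → Agree H W q q′ → Agree W H (flip q) (flip q′)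
  agree-transpose agree s t s<W t<H = agree t s t<H s<W

  row-period-agree : ∀ {H W q q′ d p len} → Agree H W q q′ → d ≤ W → len ≤ H → RowPeriod q d p len → RowPeriod q′ d p len
  row-period-agree agree d≤W len≤H =
    period-agree (Letters S _) (λ t t<len s s<d → agree t s (<-≤-trans t<len len≤H) (<-≤-trans s<d d≤W))

  row-primitive-agree : ∀ {H W q q′ d len} → Agree H W q q′ → d ≤ W → len ≤ H → RowPrimitive q d len → RowPrimitive q′ d len
  row-primitive-agree agree d≤W len≤H =
    primitive-agree (Letters S _) (λ t t<len s s<d → agree t s (<-≤-trans t<len len≤H) (<-≤-trans s<d d≤W))

module _ {S : Set} where

  -- Transposition is an involution up to record η, so every fact below is
  -- an immediate reshuffling of the definitions.
  transpose : Arr S → Arr S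
  transpose Q = mkArr (cols Q) (rows Q) (λ i j → at Q j i)

  transpose-power : ∀ {B C α β} → IsPower B C α β → IsPower (transpose B) (transpose C) β α
  transpose-power (p , q , entries) = q , p , λ b j a i → entries a i b j

  transpose-primitive : ∀ {W} → Primitive W → Primitive (transpose W)
  transpose-primitive {W} prim C α β 1≤α 1≤β pow =
    swap (prim (transpose C) β α 1≤β 1≤α (transpose-power {B = transpose W} pow))

  transpose-occurs : ∀ {n Q} {A : Fin n → Fin n → S} → OccursIn Q A → OccursIn (transpose Q) (flip A)
  transpose-occurs (r , s , c , t , p , q , entries) = c , t , r , s , q , p , λ i j → entries j i

  transpose-same : ∀ {X Y} → SameContent (transpose X) (transpose Y) → SameContent X Y
  transpose-same (p , q , entries) = q , p , λ i j → entries j i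

module _ {S : Set} where
  open Periodicity using (period-iterate)

  Presents : Arr S → (ℕ → ℕ → S) → Set
  Presents Q q = ∀ i j → at Q i j ≡ q (toℕ i) (toℕ j)

  toℕ-block : ∀ {m a r} (p : m ≡ a * r) (k : Fin a) (i : Fin r) → toℕ (cast (≡.sym p) (combine k i)) ≡ r * toℕ k + toℕ i
  toℕ-block p k i = ≡.trans (toℕ-cast _ (combine k i)) (toℕ-combine k i)

  -- Euclidean division, in the order used by toℕ-block.
  div-mod : ∀ t h .{{_ : NonZero h}} → t ≡ h * (t / h) + t % h
  div-mod t h = ≡.trans (m≡m%n+[m/n]*n t h) (≡.trans (+-comm (t % h) _) (cong (_+ t % h) (*-comm (t / h) h)))

  power-entry : ∀ {Q W a b q} → IsPower Q W a b → Presents Q q →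
                ∀ k i l j → at W i j ≡ q (rows W * toℕ k + toℕ i) (cols W * toℕ l + toℕ j)
  power-entry {q = q} (p , p′ , entries) pres k i l j =
    ≡.trans (≡.sym (entries k i l j)) (≡.trans (pres _ _) (cong₂ q (toℕ-block p k i) (toℕ-block p′ l j)))

  power-root : ∀ {Q W a b q} → 0 < a → 0 < b → IsPower Q W a b → Presents Q q → Presents W q
  power-root {W = W} {a = suc _} {b = suc _} {q} _ _ pow pres i j =
    ≡.trans (power-entry {W = W} {q = q} pow pres zero i zero j)
            (cong₂ q (cong (_+ toℕ i) (*-zeroʳ (rows W))) (cong (_+ toℕ j) (*-zeroʳ (cols W))))

  power-cell : ∀ {Q W a b q} .{{_ : NonZero (rows W)}} .{{_ : NonZero (cols W)}} → IsPower Q W a b → Presents Q q →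
               ∀ {t s} → t < a * rows W → s < b * cols W → q t s ≡ at W (t mod rows W) (s mod cols W)
  power-cell {W = W} {q = q} pow pres {t} {s} t<ah s<bw = begin
    q t s
      ≡⟨ cong₂ q (div-mod t h) (div-mod s w) ⟩
    q (h * (t / h) + t % h) (w * (s / w) + s % w)
      ≡⟨ cong₂ q (cong₂ (λ x y → h * x + y) (toℕ-fromℕ< _) (toℕ-fromℕ< _))
                 (cong₂ (λ x y → w * x + y) (toℕ-fromℕ< _) (toℕ-fromℕ< _)) ⟨
    q (h * toℕ k + toℕ (t mod h)) (w * toℕ l + toℕ (s mod w))
      ≡⟨ power-entry {W = W} {q = q} pow pres k (t mod h) l (s mod w) ⟨
    at W (t mod h) (s mod w) ∎
    where
    open ≡.≡-Reasoning
    h = rows W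
    w = cols W
    k = fromℕ< (m<n*o⇒m/o<n {t} {o = h} t<ah)
    l = fromℕ< (m<n*o⇒m/o<n {s} {o = w} s<bw)

  power-row-period : ∀ {Q W a b q} .{{_ : NonZero (rows W)}} .{{_ : NonZero (cols W)}} → IsPower Q W a b → Presents Q q →
                     RowPeriod q (b * cols W) (rows W) (a * rows W)
  power-row-period {W = W} {q = q} pow pres t t+h<ah s s<bw =
    ≡.trans (power-cell {W = W} {q = q} pow pres (≤-<-trans (m≤m+n t (rows W)) t+h<ah) s<bw)
            (≡.sym (≡.trans (power-cell {W = W} {q = q} pow pres t+h<ah s<bw)
                            (cong (λ i → at W i (s mod cols W)) (fromℕ<-cong _ _ ([m+n]%n≡m%n t (rows W)) _ _))))

  power-col-period : ∀ {Q W a b q} .{{_ : NonZero (rows W)}} .{{_ : NonZero (cols W)}} → IsPower Q W a b → Presents Q q →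
                     ColPeriod q (a * rows W) (cols W) (b * cols W)
  power-col-period {Q} {W} {q = q} pow pres =
    power-row-period {Q = transpose Q} {W = transpose W} {q = flip q} (transpose-power {B = Q} pow) (λ i j → pres j i)

  -- A primitive array is nonempty: an array with no rows is the square C^{2,1}
  -- of itself.
  primitive-rows : ∀ {W : Arr S} → Primitive W → 0 < rows W
  primitive-rows {mkArr zero c f} prim
    with () ← proj₁ (prim (mkArr 0 c f) 2 1 (s≤s z≤n) ≤-refl (refl , ≡.sym (*-identityˡ c) , λ _ ()))
  primitive-rows {mkArr (suc r) c f} prim = s≤s z≤n

  primitive-cols : ∀ {W : Arr S} → Primitive W → 0 < cols W
  primitive-cols {W} prim = primitive-rows {W = transpose W} (transpose-primitive {W = W} prim)

  -- A primitive array has no row period that is a proper divisor of its height: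
  -- otherwise it would be the k-th vertical power of its first g rows.
  primitive-row : ∀ {W p} → Primitive W → Presents W p → RowPrimitive p (cols W) (rows W)
  primitive-row {W} {p} prim pres g 0<g (divides k h≡kg) g<h Pg =
    <-irrefl (≡.sym (≡.trans h≡kg (≡.trans (cong (_* g) k≡1) (*-identityˡ g)))) g<h
    where
    open ≡.≡-Reasoning
    h = rows W
    w = cols W
    top : Arr S
    top = mkArr g w (λ i j → at W (inject≤ i (<⇒≤ g<h)) j)
    w≡1w : w ≡ 1 * w
    w≡1w = ≡.sym (*-identityˡ w)
    entries : ∀ a i (b : Fin 1) j → at W (cast (≡.sym h≡kg) (combine a i)) (cast (≡.sym w≡1w) (combine b j)) ≡ at top i j
    entries a i b@zero j = begin
      at W (cast (≡.sym h≡kg) (combine a i)) (cast (≡.sym w≡1w) (combine b j))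
        ≡⟨ pres _ _ ⟩
      p (toℕ (cast (≡.sym h≡kg) (combine a i))) (toℕ (cast (≡.sym w≡1w) (combine b j)))
        ≡⟨ cong₂ p (toℕ-block h≡kg a i) (≡.trans (toℕ-block w≡1w b j) (cong (_+ toℕ j) (*-zeroʳ w))) ⟩
      p (g * toℕ a + toℕ i) (toℕ j)
        ≡⟨ period-iterate (Letters S w) {u = p} Pg (toℕ a) (toℕ i)
             (subst (_< h) (toℕ-block h≡kg a i) (toℕ<n _)) (toℕ j) (toℕ<n j) ⟩
      p (toℕ i) (toℕ j)
        ≡⟨ cong (λ x → p x (toℕ j)) (toℕ-inject≤ i _) ⟨
      p (toℕ (inject≤ i (<⇒≤ g<h))) (toℕ j)
        ≡⟨ pres _ _ ⟨
      at W (inject≤ i (<⇒≤ g<h)) j ∎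
    positive : ∀ k → h ≡ k * g → 1 ≤ k
    positive zero h≡0 = ⊥-elim (<-irrefl refl (<-≤-trans 0<g (≤-trans (<⇒≤ g<h) (≤-reflexive h≡0))))
    positive (suc _) _ = s≤s z≤n
    k≡1 : k ≡ 1
    k≡1 = proj₁ (prim top k 1 (positive k h≡kg) ≤-refl (h≡kg , w≡1w , entries))

  primitive-col : ∀ {W p} → Primitive W → Presents W p → ColPrimitive p (rows W) (cols W)
  primitive-col {W} {p} prim pres = primitive-row {W = transpose W} {p = flip p} (transpose-primitive {W = W} prim) (λ i j → pres j i)

presentation-content : ∀ {S} {X Y : Arr S} {q} → Presents X q → Presents Y q →
                       rows X ≡ rows Y → cols X ≡ cols Y → SameContent X Y
presentation-content {q = q} presX presY p p′ =
  p , p′ , λ i j → ≡.trans (presX i j)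
                           (≡.trans (cong₂ q (≡.sym (toℕ-cast p i)) (≡.sym (toℕ-cast p′ j))) (≡.sym (presY _ _)))

refute-sorted : {X : Set} (m : X → ℕ) (P : X → X → X → Set) →
                (∀ {x y z} → P x y z → P y x z) → (∀ {x y z} → P x y z → P x z y) →
                (∀ {x y z} → m x ≤ m y → m y ≤ m z → P x y z → ⊥) →
                ∀ {x y z} → P x y z → ⊥
refute-sorted m P swap₁₂ swap₂₃ sorted {x} {y} {z} p
  with ≤-total (m x) (m y) | ≤-total (m y) (m z) | ≤-total (m x) (m z)
... | inj₁ x≤y | inj₁ y≤z | _        = sorted x≤y y≤z p
... | inj₁ x≤y | inj₂ z≤y | inj₁ x≤z = sorted x≤z z≤y (swap₂₃ p)
... | inj₁ x≤y | inj₂ z≤y | inj₂ z≤x = sorted z≤x x≤y (swap₁₂ (swap₂₃ p))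
... | inj₂ y≤x | inj₁ y≤z | inj₁ x≤z = sorted y≤x x≤z (swap₁₂ p)
... | inj₂ y≤x | inj₁ y≤z | inj₂ z≤x = sorted y≤z z≤x (swap₂₃ (swap₁₂ p))
... | inj₂ y≤x | inj₂ z≤y | _        = sorted z≤y y≤x (swap₁₂ (swap₂₃ (swap₁₂ p)))

length-split : ∀ {X : Set} {P : X → Set} (P? : Decidable P) xs →
               length xs ≡ length (filter P? xs) + length (filter (¬? ∘ P?) xs)
length-split P? [] = refl
length-split P? (x ∷ xs) with P? x
... | yes _ = cong suc (length-split P? xs)
... | no _ = ≡.trans (cong suc (length-split P? xs)) (≡.sym (+-suc _ _))

module Counting {X : Set} (R : X → X → Set) (key : X → ℕ) where

  AtMostTwoPerKey : Set
  AtMostTwoPerKey = ∀ x y z → R x y → R x z → R y z → key x ≡ key y → key x ≡ key z → ⊥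

  one-key : AtMostTwoPerKey → ∀ {k} xs → AllPairs R xs → All (λ x → key x ≡ k) xs → length xs ≤ 2
  one-key _ [] _ _ = z≤n
  one-key _ (_ ∷ []) _ _ = s≤s z≤n
  one-key _ (_ ∷ _ ∷ []) _ _ = s≤s (s≤s z≤n)
  one-key no-three (x ∷ y ∷ z ∷ _) ((rxy ∷ rxz ∷ _) ∷ (ryz ∷ _) ∷ _) (kx ∷ ky ∷ kz ∷ _) =
    ⊥-elim (no-three x y z rxy rxz ryz (≡.trans kx (≡.sym ky)) (≡.trans kx (≡.sym kz)))

  -- by induction on K, separating the elements with the largest key K - 1
  count : AtMostTwoPerKey → ∀ K xs → AllPairs R xs → All (λ x → key x < K) xs → length xs ≤ 2 * K
  count _ zero [] _ _ = z≤n
  count _ zero (_ ∷ _) _ (() ∷ _)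
  count no-three (suc K) xs pairwise bounded = begin
    length xs                                              ≡⟨ length-split top? xs ⟩
    length (filter top? xs) + length (filter (¬? ∘ top?) xs) ≤⟨ +-mono-≤ at-top below-top ⟩
    2 + 2 * K                                              ≡⟨ *-suc 2 K ⟨
    2 * suc K                                              ∎
    where
    open ≤-Reasoning
    top? : Decidable (λ x → key x ≡ K)
    top? x = key x ≟ K
    at-top : length (filter top? xs) ≤ 2
    at-top = one-key no-three (filter top? xs) (AllPairs.filter⁺ top? pairwise) (AllP.all-filter top? xs)
    below-top : length (filter (¬? ∘ top?) xs) ≤ 2 * K
    below-top = count no-three K _ (AllPairs.filter⁺ (¬? ∘ top?) pairwise)
      (All.zipWith (λ (lt , ne) → ≤∧≢⇒< (≤-pred lt) ne)
                   (AllP.filter⁺ (¬? ∘ top?) bounded , AllP.all-filter (¬? ∘ top?) xs))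

map-proj₁-toList : ∀ {X : Set} {P : X → Set} {xs} (ps : All P xs) → map proj₁ (All.toList ps) ≡ xs
map-proj₁-toList [] = refl
map-proj₁-toList (p ∷ ps) = cong (_ ∷_) (map-proj₁-toList ps)

classical-maximum : ∀ {n} (P : ℕ → Set) → (∀ c → P c → c < n) → ∀ {c₀} → P c₀ →
                    ¬ ¬ (∃ λ c → P c × ∀ c′ → c < c′ → ¬ P c′)
classical-maximum {n} P bound {c₀} Pc₀ = search n c₀ (m≤n+m n c₀) Pc₀
  where
  open RawMonad ¬¬-Monad
  -- k bounds the distance from c to n
  search : ∀ k c → n ≤ c + k → P c → ¬ ¬ (∃ λ c → P c × ∀ c′ → c < c′ → ¬ P c′)
  search zero c n≤c Pc = ⊥-elim (<-irrefl refl (<-≤-trans (bound c Pc) (subst (n ≤_) (+-identityʳ c) n≤c)))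
  search (suc k) c n≤c+1+k Pc = ¬¬-excluded-middle {A = ∃ λ c′ → c < c′ × P c′} >>= λ where
    (yes (c′ , c<c′ , Pc′)) → search k c′ (≤-trans n≤c+1+k (≤-trans (≤-reflexive (+-suc c k)) (+-monoˡ-≤ k c<c′))) Pc′
    (no none) → pure (c , Pc , λ c′ c<c′ Pc′ → none (c′ , c<c′ , Pc′))

window : {S : Set} → (ℕ → ℕ → S) → ℕ → ℕ → ℕ → ℕ → S
window B r c t s = B (r + t) (c + s)

width-bound : ∀ {k w β} → 2 ≤ β → k ≤ 2 * (2 * w) → k ≤ 2 * β * w
width-bound {k} {w} 2≤β k≤4w = ≤-trans k≤4w (≤-trans (≤-reflexive (≡.sym (*-assoc 2 2 w))) (*-monoˡ-≤ w (*-monoʳ-≤ 2 2≤β)))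

h≤2h : ∀ h → h ≤ 2 * h
h≤2h h = m≤m+n h (h + 0)

w≤2βw : ∀ {w β} → 2 ≤ β → w ≤ 2 * β * w
w≤2βw {w} 2≤β = width-bound 2≤β (≤-trans (h≤2h w) (h≤2h (2 * w)))

pair-bound : ∀ {w w′} → w′ < 2 * w → w + w′ ≤ 2 * (2 * w)
pair-bound {w} w′<2w = ≤-trans (+-mono-≤ (h≤2h w) (<⇒≤ w′<2w)) (≤-reflexive (≡.sym (twice (2 * w))))

module Frames {S : Set} (n : ℕ) (B : ℕ → ℕ → S) where
  open Periodicity

  OccursAt : ℕ → ℕ → (ℕ → ℕ → S) → ℕ → ℕ → Set
  OccursAt H W q r c = r + H ≤ n × c + W ≤ n × Agree H W q (window B r c)

  record Frame (r c h w β : ℕ) : Set where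
    field
      0<h           : 0 < h
      0<w           : 0 < w
      2≤β           : 2 ≤ β
      row-fits      : r + 2 * h ≤ n
      col-fits      : c + 2 * β * w ≤ n
      row-periodic  : RowPeriod (window B r c) (2 * β * w) h (2 * h)
      col-periodic  : ColPeriod (window B r c) (2 * h) w (2 * β * w)
      row-primitive : RowPrimitive (window B r c) w h
      col-primitive : ColPrimitive (window B r c) h w
      rightmost     : ∀ r′ c′ → c < c′ → ¬ OccursAt (2 * h) (2 * β * w) (window B r c) r′ c′
  open Frame

  divisor-period-is-width : ∀ {r c h w β g L} → Frame r c h w β → 0 < g → g ∣ w → w ≤ L →
                            ColPeriod (window B r c) (2 * h) g L → g ≡ w
  divisor-period-is-width {h = h} f 0<g g∣w w≤L P =
    primitive-divisor (Letters S h) (col-primitive f) (0<w f) 0<g g∣w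
      (narrow (h≤2h h) (period-prefix (Letters S (2 * h)) w≤L P))

  -- Frames at the same position with the same height and widths within a factor
  -- 2 have the same width (Fine–Wilf on the columns, then primitivity).
  width-unique : ∀ {r c h w w′ β β′} → Frame r c h w β → Frame r c h w′ β′ → w < 2 * w′ → w′ < 2 * w → w ≡ w′
  width-unique {r} {c} {h} {w} {w′} f f′ w<2w′ w′<2w = conclude common
    where
    columns = Letters S (2 * h)
    common : CommonDivisorPeriod columns (flip (window B r c)) w w′ (w + w′)
    common = fine-wilf columns (0<w f) (0<w f′) ≤-refl
               (period-prefix columns (width-bound (2≤β f) (pair-bound w′<2w)) (col-periodic f))
               (period-prefix columns (width-bound (2≤β f′) (subst (_≤ 2 * (2 * w′)) (+-comm w′ w) (pair-bound w<2w′)))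
                              (col-periodic f′))
    conclude : CommonDivisorPeriod columns (flip (window B r c)) w w′ (w + w′) → w ≡ w′
    conclude (g , 0<g , g∣w , g∣w′ , Pg) =
      ≡.trans (≡.sym (divisor-period-is-width f 0<g g∣w (m≤m+n w w′) Pg))
              (divisor-period-is-width f′ 0<g g∣w′ (m≤n+m w′ w) Pg)

  -- A frame with fewer repetitions than another frame of the same root would
  -- reoccur w columns to the right, contradicting rightmost occurrence.
  exponent-maximal : ∀ {r c h w β β′} → Frame r c h w β → Frame r c h w β′ → β < β′ → ⊥
  exponent-maximal {r} {c} {h} {w} {β} {β′} f f′ β<β′ =
    rightmost f r (c + w) (m<m+n c (0<w f)) (row-fits f , fits , shifted)
    where
    reach : 2 * β * w + w + w ≤ 2 * β′ * w
    reach = ≤-trans (≤-reflexive (expand β w)) (*-monoˡ-≤ w (*-monoʳ-≤ 2 β<β′))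
      where
      expand : ∀ β w → 2 * β * w + w + w ≡ 2 * suc β * w
      expand = solve-∀
    shift : ∀ c w s → c + (s + w) ≡ c + w + s
    shift = solve-∀
    fits : c + w + 2 * β * w ≤ n
    fits = ≤-trans (≤-reflexive (≡.sym (shift c w _))) (≤-trans (+-monoʳ-≤ c (≤-trans (m≤m+n _ w) reach)) (col-fits f′))
    -- the columns of f′ have period w far enough to carry the window of f along
    shifted : Agree (2 * h) (2 * β * w) (window B r c) (window B r (c + w))
    shifted t s t<2h s<2βw =
      ≡.trans (col-periodic f′ s (<-≤-trans (+-monoˡ-< w s<2βw) (≤-trans (m≤m+n _ w) reach)) t t<2h)
              (cong (B (r + t)) (shift c w s))

  exponent-unique : ∀ {r c h w β β′} → Frame r c h w β → Frame r c h w β′ → β ≡ β′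
  exponent-unique {β = β} {β′} f f′ with <-cmp β β′
  ... | tri< β<β′ _ _ = ⊥-elim (exponent-maximal f f′ β<β′)
  ... | tri≈ _ β≡β′ _ = β≡β′
  ... | tri> _ _ β′<β = ⊥-elim (exponent-maximal f′ f β′<β)

  -- Three frames at the same position with heights h₁ < h₂ < h₃ < 2h₁ and widths
  -- exceeding w₁ / 2 contradict the three-squares lemma on the rows.
  three-heights : ∀ {r c h₁ h₂ h₃ w₁ w₂ w₃ β₁ β₂ β₃} →
                  Frame r c h₁ w₁ β₁ → Frame r c h₂ w₂ β₂ → Frame r c h₃ w₃ β₃ →
                  h₁ < h₂ → h₂ < h₃ → h₃ < 2 * h₁ → w₁ < 2 * w₂ → w₁ < 2 * w₃ → ⊥
  three-heights {r} {c} {w₁ = w₁} f₁ f₂ f₃ h₁<h₂ h₂<h₃ h₃<2h₁ w₁<2w₂ w₁<2w₃ =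
    three-squares (Letters S (2 * w₁)) h₁<h₂ h₂<h₃ h₃<2h₁
      (square f₁ (subst (w₁ <_) (≡.sym (twice w₁)) (m<m+n w₁ (0<w f₁)))) (square f₂ w₁<2w₂) (square f₃ w₁<2w₃)
      (widen-primitive (h≤2h w₁) (row-primitive f₁))
    where
    -- the rows of each frame form a square for letters of width 2w₁
    square : ∀ {h w β} → Frame r c h w β → w₁ < 2 * w → RowPeriod (window B r c) (2 * w₁) h (2 * h)
    square f w₁<2w = narrow (width-bound (2≤β f) (*-monoʳ-≤ 2 (<⇒≤ w₁<2w))) (row-periodic f)

  record Anchored (r c : ℕ) (Q : Arr S) : Set where
    constructor anchored
    field
      h w β   : ℕ
      frame   : Frame r c h w β
      rows≡   : rows Q ≡ 2 * h
      cols≡   : cols Q ≡ 2 * β * w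
      content : Presents Q (window B r c)
  open Anchored

  SameShape : ∀ {r c Q Q′} → Anchored r c Q → Anchored r c Q′ → Set
  SameShape a a′ = h a ≡ h a′ × w a ≡ w a′ × β a ≡ β a′

  same-shape-content : ∀ {r c Q Q′} (a : Anchored r c Q) (a′ : Anchored r c Q′) → SameShape a a′ → SameContent Q Q′
  same-shape-content {r} {c} {Q} {Q′} a a′ (refl , refl , refl) =
    presentation-content {X = Q} {Y = Q′} {q = window B r c} (content a) (content a′)
      (≡.trans (rows≡ a) (≡.sym (rows≡ a′))) (≡.trans (cols≡ a) (≡.sym (cols≡ a′)))

  Class : ∀ {r c Q} → Anchored r c Q → ℕ × ℕ
  Class a = ⌊log₂ h a ⌋ , ⌊log₂ w a ⌋

  equal-heights : ∀ {r c Q Q′} (a : Anchored r c Q) (a′ : Anchored r c Q′) →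
                  h a ≡ h a′ → w a < 2 * w a′ → w a′ < 2 * w a → SameShape a a′
  equal-heights (anchored ht wd ex f _ _ _) (anchored .ht wd′ ex′ f′ _ _ _) refl w<2w′ w′<2w
    with width-unique f f′ w<2w′ w′<2w
  ... | refl = refl , refl , exponent-unique f f′

  module _ {r c : ℕ} where

    Point : Set
    Point = Σ (Arr S) (Anchored r c)

    height width : Point → ℕ
    height x = h (proj₂ x)
    width x = w (proj₂ x)

    Apart : Point → Point → Set
    Apart x y = ¬ SameShape (proj₂ x) (proj₂ y)

    apart-sym : ∀ x y → Apart x y → Apart y x
    apart-sym _ _ xy (e₁ , e₂ , e₃) = xy (≡.sym e₁ , ≡.sym e₂ , ≡.sym e₃)

    Spread : ℕ × ℕ → Point → Point → Point → Set
    Spread k x y z = Class (proj₂ x) ≡ k × Class (proj₂ y) ≡ k × Class (proj₂ z) ≡ k × Apart x y × Apart x z × Apart y z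

    height-close : ∀ {k} x y → Class (proj₂ x) ≡ k → Class (proj₂ y) ≡ k → height x < 2 * height y
    height-close x y cx cy = dyadic-close (0<h (frame (proj₂ y))) (cong proj₁ (≡.trans cx (≡.sym cy)))

    width-close : ∀ {k} x y → Class (proj₂ x) ≡ k → Class (proj₂ y) ≡ k → width x < 2 * width y
    width-close x y cx cy = dyadic-close (0<w (frame (proj₂ y))) (cong proj₂ (≡.trans cx (≡.sym cy)))

    -- A spread sorted by height either repeats a height or has three heights
    -- h₁ < h₂ < h₃ < 2h₁; both are impossible.
    sorted-spread : ∀ {k} x y z → height x ≤ height y → height y ≤ height z → Spread k x y z → ⊥
    sorted-spread x y z hx≤hy hy≤hz (cx , cy , cz , xy , xz , yz)
      with m≤n⇒m<n∨m≡n hx≤hy | m≤n⇒m<n∨m≡n hy≤hz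
    ... | inj₂ hx≡hy | _ = xy (equal-heights (proj₂ x) (proj₂ y) hx≡hy (width-close x y cx cy) (width-close y x cy cx))
    ... | inj₁ _ | inj₂ hy≡hz = yz (equal-heights (proj₂ y) (proj₂ z) hy≡hz (width-close y z cy cz) (width-close z y cz cy))
    ... | inj₁ hx<hy | inj₁ hy<hz =
      three-heights (frame (proj₂ x)) (frame (proj₂ y)) (frame (proj₂ z)) hx<hy hy<hz
        (height-close z x cz cx) (width-close x y cx cy) (width-close x z cx cz)

  at-most-two : ∀ {r c Q₁ Q₂ Q₃} (a₁ : Anchored r c Q₁) (a₂ : Anchored r c Q₂) (a₃ : Anchored r c Q₃) →
                Class a₁ ≡ Class a₂ → Class a₁ ≡ Class a₃ → Distinct Q₁ Q₂ → Distinct Q₁ Q₃ → Distinct Q₂ Q₃ → ⊥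
  at-most-two {r} {c} {Q₁} {Q₂} {Q₃} a₁ a₂ a₃ c₁₂ c₁₃ d₁₂ d₁₃ d₂₃ =
    refute-sorted (height {r} {c}) (Spread (Class a₁))
      (λ {x} {y} {z} (cx , cy , cz , xy , xz , yz) → cy , cx , cz , apart-sym x y xy , yz , xz)
      (λ {x} {y} {z} (cx , cy , cz , xy , xz , yz) → cx , cz , cy , xz , xy , apart-sym y z yz)
      (λ {x} {y} {z} → sorted-spread x y z) {Q₁ , a₁} {Q₂ , a₂} {Q₃ , a₃}
      (refl , ≡.sym c₁₂ , ≡.sym c₁₃ , apart a₁ a₂ d₁₂ , apart a₁ a₃ d₁₃ , apart a₂ a₃ d₂₃)
    where
    apart : ∀ {r c Q Q′} (a : Anchored r c Q) (a′ : Anchored r c Q′) → Distinct Q Q′ → Apart (Q , a) (Q′ , a′)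
    apart a a′ d same = d (same-shape-content a a′ same)

  M : ℕ
  M = suc ⌊log₂ n ⌋

  Key : Set
  Key = Fin (n * (n * (M * M)))

  encode : Fin n → Fin n → Fin M → Fin M → Key
  encode i j k l = combine i (combine j (combine k l))

  encode-injective : ∀ {i j k l i′ j′ k′ l′} → encode i j k l ≡ encode i′ j′ k′ l′ →
                     i ≡ i′ × j ≡ j′ × k ≡ k′ × l ≡ l′
  encode-injective {i} {j} {k} {l} {i′} {j′} {k′} {l′} eq
    with combine-injective i _ i′ _ eq
  ... | refl , eq₁ with combine-injective j _ j′ _ eq₁
  ... | refl , eq₂ with combine-injective k l k′ l′ eq₂
  ... | refl , refl = refl , refl , refl , refl

  module _ {r c Q} (a : Anchored r c Q) where
    private
      f = frame a

    r<n : r < n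
    r<n = <-≤-trans (m<m+n r (<-≤-trans (0<h f) (h≤2h _))) (row-fits f)

    c<n : c < n
    c<n = <-≤-trans (m<m+n c (<-≤-trans (0<w f) (w≤2βw (2≤β f)))) (col-fits f)

    log-h<M : ⌊log₂ h a ⌋ < M
    log-h<M = s≤s (⌊log₂⌋-mono-≤ {h a} (≤-trans (h≤2h _) (≤-trans (m≤n+m _ r) (row-fits f))))

    log-w<M : ⌊log₂ w a ⌋ < M
    log-w<M = s≤s (⌊log₂⌋-mono-≤ {w a} (≤-trans (w≤2βw (2≤β f)) (≤-trans (m≤n+m _ c) (col-fits f))))

    anchor-key : Key
    anchor-key = encode (fromℕ< r<n) (fromℕ< c<n) (fromℕ< log-h<M) (fromℕ< log-w<M)

  anchor-key-injective : ∀ {r c r′ c′ Q Q′} (a : Anchored r c Q) (a′ : Anchored r′ c′ Q′) →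
                         anchor-key a ≡ anchor-key a′ → r ≡ r′ × c ≡ c′ × Class a ≡ Class a′
  anchor-key-injective a a′ same with encode-injective same
  ... | er , ec , eh , ew = unpack er , unpack ec , cong₂ _,_ (unpack eh) (unpack ew)
    where
    unpack : ∀ {x y m} .{x<m : x < m} .{y<m : y < m} → fromℕ< x<m ≡ fromℕ< y<m → x ≡ y
    unpack {x<m = x<m} {y<m} eq = ≡.trans (≡.sym (toℕ-fromℕ< x<m)) (≡.trans (cong toℕ eq) (toℕ-fromℕ< y<m))

  key-at-most-two : ∀ {r₁ c₁ r₂ c₂ r₃ c₃ Q₁ Q₂ Q₃}
                    (a₁ : Anchored r₁ c₁ Q₁) (a₂ : Anchored r₂ c₂ Q₂) (a₃ : Anchored r₃ c₃ Q₃) →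
                    anchor-key a₁ ≡ anchor-key a₂ → anchor-key a₁ ≡ anchor-key a₃ →
                    Distinct Q₁ Q₂ → Distinct Q₁ Q₃ → Distinct Q₂ Q₃ → ⊥
  key-at-most-two a₁ a₂ a₃ k₁₂ k₁₃ with anchor-key-injective a₁ a₂ k₁₂ | anchor-key-injective a₁ a₃ k₁₃
  ... | refl , refl , c₁₂ | refl , refl , c₁₃ = at-most-two a₁ a₂ a₃ c₁₂ c₁₃

  rightmost-frame : ∀ {Q W β q r c} → Primitive W → 2 ≤ β → IsPower Q W 2 (2 * β) → Presents Q q →
                    OccursAt (2 * rows W) (2 * β * cols W) q r c →
                    (∀ r′ c′ → c < c′ → ¬ OccursAt (2 * rows W) (2 * β * cols W) q r′ c′) →
                    Frame r c (rows W) (cols W) β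
  rightmost-frame {Q} {W} {β} {q} prim 2≤β pow pres (r-fits , c-fits , agree) maximal = record
    { 0<h           = rows-pos
    ; 0<w           = cols-pos
    ; 2≤β           = 2≤β
    ; row-fits      = r-fits
    ; col-fits      = c-fits
    ; row-periodic  = row-period-agree agree ≤-refl ≤-refl (power-row-period {W = W} {q = q} pow pres)
    ; col-periodic  = row-period-agree (agree-transpose agree) ≤-refl ≤-refl (power-col-period {W = W} {q = q} pow pres)
    ; row-primitive = row-primitive-agree agree (w≤2βw 2≤β) (h≤2h (rows W)) (primitive-row {W = W} prim root)
    ; col-primitive = row-primitive-agree (agree-transpose agree) (h≤2h (rows W)) (w≤2βw 2≤β) (primitive-col {W = W} prim root)
    ; rightmost     = λ r′ c′ c<c′ (r′-fits , c′-fits , agree′) →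
                        maximal r′ c′ c<c′
                          (r′-fits , c′-fits , λ t s t<H s<W → ≡.trans (agree t s t<H s<W) (agree′ t s t<H s<W))
    }
    where
    rows-pos : 0 < rows W
    rows-pos = primitive-rows {W = W} prim
    cols-pos : 0 < cols W
    cols-pos = primitive-cols {W = W} prim
    instance
      rows≢0 : NonZero (rows W)
      rows≢0 = >-nonZero rows-pos
      cols≢0 : NonZero (cols W)
      cols≢0 = >-nonZero cols-pos
    root : Presents W q
    root = power-root {W = W} {q = q} (s≤s z≤n) (<-≤-trans (s≤s z≤n) (*-monoʳ-≤ 2 2≤β)) pow pres

  anchor : ∀ {Q W β r₀ c₀} → Primitive W → 2 ≤ β → IsPower Q W 2 (2 * β) →
           Presents Q (window B r₀ c₀) → r₀ + rows Q ≤ n → c₀ + cols Q ≤ n → ¬ ¬ (∃₂ λ r c → Anchored r c Q)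
  anchor {Q} {W} {β} {r₀} {c₀} prim 2≤β pow@(rows≡ , cols≡ , _) pres r₀-fits c₀-fits = do
    (c , (r , occ) , maximal) ← classical-maximum ColumnOfOccurrence column-bound (r₀ , initial)
    pure (r , c , anchoring occ (λ r′ c′ c<c′ occ′ → maximal c′ c<c′ (r′ , occ′)))
    where
    open RawMonad ¬¬-Monad
    q = window B r₀ c₀
    H = 2 * rows W
    Wd = 2 * β * cols W
    ColumnOfOccurrence : ℕ → Set
    ColumnOfOccurrence c = ∃ λ r → OccursAt H Wd q r c
    column-bound : ∀ c → ColumnOfOccurrence c → c < n
    column-bound c (_ , _ , c-fits , _) = <-≤-trans (m<m+n c (<-≤-trans (primitive-cols {W = W} prim) (w≤2βw 2≤β))) c-fits
    initial : OccursAt H Wd q r₀ c₀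
    initial = subst (λ x → r₀ + x ≤ n) rows≡ r₀-fits , subst (λ x → c₀ + x ≤ n) cols≡ c₀-fits , λ _ _ _ _ → refl
    anchoring : ∀ {r c} → OccursAt H Wd q r c → (∀ r′ c′ → c < c′ → ¬ OccursAt H Wd q r′ c′) → Anchored r c Q
    anchoring occ@(_ , _ , agree) maximal =
      anchored (rows W) (cols W) β (rightmost-frame prim 2≤β pow pres occ maximal) rows≡ cols≡
        (λ i j → ≡.trans (pres i j)
                         (agree (toℕ i) (toℕ j) (subst (toℕ i <_) rows≡ (toℕ<n i)) (subst (toℕ j <_) cols≡ (toℕ<n j))))

HorizontalQuartic : ∀ {S} → Arr S → Set
HorizontalQuartic Q = ∃₂ λ W β → Primitive W × 2 ≤ β × IsPower Q W 2 (2 * β)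

thin-orientation : ∀ {S} {Q : Arr S} → ThinQuartic Q → HorizontalQuartic Q ⊎ HorizontalQuartic (transpose Q)
thin-orientation {Q = Q} (W , α , β , prim , _ , _ , big , thin , pow) with thin | big
... | inj₁ refl | inj₁ (s≤s ())
... | inj₁ refl | inj₂ 1<β = inj₁ (W , β , prim , 1<β , pow)
... | inj₂ refl | inj₁ 1<α = inj₂ (transpose W , α , transpose-primitive {W = W} prim , 1<α , transpose-power {B = Q} pow)
... | inj₂ refl | inj₂ (s≤s ())

extend : ∀ {S : Set} {n} .{{_ : NonZero n}} → (Fin n → Fin n → S) → ℕ → ℕ → S
extend {n = n} A i j = A (i mod n) (j mod n)

mod-index : ∀ {n} .{{_ : NonZero n}} (x : Fin n) {i} → toℕ x ≡ i → i mod n ≡ x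
mod-index x refl = toℕ-injective (≡.trans (toℕ-fromℕ< _) (m<n⇒m%n≡m (toℕ<n x)))

occurrence-window : ∀ {S n} .{{_ : NonZero n}} {A : Fin n → Fin n → S} {Q} → OccursIn Q A →
                    ∃₂ λ r c → Presents Q (window (extend A) r c) × r + rows Q ≤ n × c + cols Q ≤ n
occurrence-window {A = A} (r , s , c , t , p , q , entries) =
  r , c , (λ i j → ≡.trans (entries i j) (cong₂ A (≡.sym (mod-index _ (index r s p i))) (≡.sym (mod-index _ (index c t q j))))) ,
  ≤-trans (m≤m+n _ s) (≤-reflexive p) , ≤-trans (m≤m+n _ t) (≤-reflexive q)
  where
  index : ∀ {k n} r s (p : r + k + s ≡ n) (i : Fin k) → toℕ (cast p ((r ↑ʳ i) ↑ˡ s)) ≡ r + toℕ i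
  index r s p i = ≡.trans (toℕ-cast p _) (≡.trans (toℕ-↑ˡ (r ↑ʳ i) s) (toℕ-↑ʳ r i))

module Census {S : Set} (m : ℕ) (A : Fin (suc m) → Fin (suc m) → S) where
  open RawMonad (¬¬-Monad {a = 0ℓ})
  n = suc m
  B = extend A
  module H = Frames n B
  module V = Frames n (flip B)

  Info : Arr S → Set
  Info Q = (∃₂ λ r c → H.Anchored r c Q) ⊎ (∃₂ λ r c → V.Anchored r c (transpose Q))

  classify : ∀ {Q} → ThinQuartic Q → OccursIn Q A → ¬ ¬ Info Q
  classify {Q} thin occ with thin-orientation {Q = Q} thin
  ... | inj₁ (W , β , prim , 2≤β , pow) with occurrence-window {A = A} occ
  ...   | r , c , pres , r-fits , c-fits = inj₁ <$> H.anchor {Q = Q} {W = W} prim 2≤β pow pres r-fits c-fits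
  classify {Q} thin occ | inj₂ (W , β , prim , 2≤β , pow) with occurrence-window {A = flip A} (transpose-occurs {Q = Q} {A = A} occ)
  ...   | r , c , pres , r-fits , c-fits = inj₂ <$> V.anchor {Q = transpose Q} {W = W} prim 2≤β pow pres r-fits c-fits

  K : ℕ
  K = n * (n * (H.M * H.M))

  side-key : ∀ {Q} → Info Q → Fin K ⊎ Fin K
  side-key (inj₁ (_ , _ , a)) = inj₁ (H.anchor-key a)
  side-key (inj₂ (_ , _ , a)) = inj₂ (V.anchor-key a)

  Point : Set
  Point = Σ (Arr S) Info

  key : Point → ℕ
  key (_ , i) = toℕ (join K K (side-key i))

  key-injective : ∀ (x y : Point) → key x ≡ key y → side-key (proj₂ x) ≡ side-key (proj₂ y)
  key-injective (_ , i) (_ , i′) eq = begin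
    side-key i                            ≡⟨ splitAt-join K K (side-key i) ⟨
    splitAt K (join K K (side-key i))     ≡⟨ cong (splitAt K) (toℕ-injective eq) ⟩
    splitAt K (join K K (side-key i′))    ≡⟨ splitAt-join K K (side-key i′) ⟩
    side-key i′                           ∎
    where open ≡.≡-Reasoning

  Apart : Point → Point → Set
  Apart x y = Distinct (proj₁ x) (proj₁ y)

  transposed : ∀ {X Y : Arr S} → Distinct X Y → Distinct (transpose X) (transpose Y)
  transposed {X} {Y} d = d ∘ transpose-same {X = X} {Y = Y}

  no-three : Counting.AtMostTwoPerKey Apart key
  no-three x@(Q₁ , i₁) y@(Q₂ , i₂) z@(Q₃ , i₃) d₁₂ d₁₃ d₂₃ k₁₂ k₁₃ =
    sides i₁ i₂ i₃ (key-injective x y k₁₂) (key-injective x z k₁₃)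
    where
    sides : (i₁ : Info Q₁) (i₂ : Info Q₂) (i₃ : Info Q₃) → side-key i₁ ≡ side-key i₂ → side-key i₁ ≡ side-key i₃ → ⊥
    sides (inj₁ (_ , _ , a₁)) (inj₁ (_ , _ , a₂)) (inj₁ (_ , _ , a₃)) e₁₂ e₁₃ =
      H.key-at-most-two a₁ a₂ a₃ (inj₁-injective e₁₂) (inj₁-injective e₁₃) d₁₂ d₁₃ d₂₃
    sides (inj₂ (_ , _ , a₁)) (inj₂ (_ , _ , a₂)) (inj₂ (_ , _ , a₃)) e₁₂ e₁₃ =
      V.key-at-most-two a₁ a₂ a₃ (inj₂-injective e₁₂) (inj₂-injective e₁₃)
        (transposed {Q₁} {Q₂} d₁₂) (transposed {Q₁} {Q₃} d₁₃) (transposed {Q₂} {Q₃} d₂₃)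
    sides (inj₁ _) (inj₂ _) _ () _
    sides (inj₂ _) (inj₁ _) _ () _
    sides (inj₁ _) (inj₁ _) (inj₂ _) _ ()
    sides (inj₂ _) (inj₂ _) (inj₁ _) _ ()

  census : ∀ L → AllPairs Distinct L → All (λ Q → ThinQuartic Q × OccursIn Q A) L → ¬ ¬ (length L ≤ 2 * (K + K))
  census L distinct quartics = bound <$> All.mapM 0ℓ ¬¬-Monad (λ (thin , occ) → classify thin occ) quartics
    where
    bound : All Info L → length L ≤ 2 * (K + K)
    bound infos = subst (_≤ 2 * (K + K)) same-length
      (Counting.count Apart key no-three (K + K) points pairwise (All.universal (λ _ → toℕ<n _) points))
      where
      points : List Point
      points = All.toList infos
      same-length : length points ≡ length L
      same-length = ≡.trans (≡.sym (length-map proj₁ points)) (cong length (map-proj₁-toList infos))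
      pairwise : AllPairs Apart points
      pairwise = AllPairs.map⁻ (subst (AllPairs Distinct) (≡.sym (map-proj₁-toList infos)) distinct)

log-square-bound : ∀ n L → 1 ≤ L → 2 * (n * (n * (suc L * suc L)) + n * (n * (suc L * suc L))) ≤ 16 * (n * n) * (L ^ 2)
log-square-bound n L 1≤L = ≤-trans (*-monoʳ-≤ 2 (+-mono-≤ grow grow)) (≤-reflexive (expand n L))
  where
  1+L≤2L : suc L ≤ L + L
  1+L≤2L = +-monoˡ-≤ L 1≤L
  grow : n * (n * (suc L * suc L)) ≤ n * (n * ((L + L) * (L + L)))
  grow = *-monoʳ-≤ n (*-monoʳ-≤ n (*-mono-≤ 1+L≤2L 1+L≤2L))
  -- L ^ 2 unfolds to L * (L * 1)
  expand : ∀ n L → 2 * (n * (n * ((L + L) * (L + L))) + n * (n * ((L + L) * (L + L)))) ≡ 16 * (n * n) * (L * (L * 1))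
  expand = solve-∀

lemma14 : ∃ λ C → ∃ λ N → (S : Set) (n : ℕ) → N ≤ n →
    (A : Fin n → Fin n → S) (L : List (Arr S)) →
    AllPairs Distinct L → All (λ Q → ThinQuartic Q × OccursIn Q A) L →
    length L ≤ C * (n * n) * (⌊log₂ n ⌋ ^ 2)
lemma14 = 16 , 2 , thin-quartic-bound
  where
  thin-quartic-bound : (S : Set) (n : ℕ) → 2 ≤ n → (A : Fin n → Fin n → S) (L : List (Arr S)) →
                       AllPairs Distinct L → All (λ Q → ThinQuartic Q × OccursIn Q A) L →
                       length L ≤ 16 * (n * n) * (⌊log₂ n ⌋ ^ 2)
  thin-quartic-bound S (suc m) 2≤n A L distinct quartics =
    decidable-stable (_ ≤? _)
      (¬¬-map (λ counted → ≤-trans counted (log-square-bound (suc m) ⌊log₂ suc m ⌋ (⌊log₂⌋-mono-≤ {2} 2≤n)))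
              (Census.census m A L distinct quartics))
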